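{- Let $r\geqslant 1$ and $m\geqslant 1$ be integers, and let $a_1,\dots,a_{2m}$ be positive integers such that $a_1$ and $a_{2m}$ are odd while $a_2,\dots,a_{2m-1}$ are even. Then the word $$W=\mathtt{1}^{a_1}\mathtt{0}^{r}\mathtt{1}^{a_2}\mathtt{0}^{r}\mathtt{1}^{a_3}\cdots\mathtt{1}^{a_{2m-1}}\mathtt{0}^{r}\mathtt{1}^{a_{2m}}$$ is not a shuffle square. In particular, the word $(\mathtt{1}\mathtt{0}^r\mathtt1)^{2m-1}$ is not a shuffle square.
   Context: $w^r$ denotes $r$ consecutive copies of the letter $w$; $U^k$ denotes the concatenation of $k$ copies of the word $U$. A word $W$ is a shuffle square if its positions can be partitioned into the supports of two subsequences that are equal as words. -}

module Defs where

open import Data.Bool using (Bool; true; false)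
open import Data.Nat using (ℕ; zero; suc; _*_)
open import Data.List using (List; []; _∷_; _++_; replicate; concat; map)
open import Data.Vec using (Vec; toList)
open import Data.Product using (∃)
open import Data.List.Relation.Ternary.Interleaving.Propositional using (Interleaving)

Word : Set
Word = List Bool

𝟙 𝟘 : Bool
𝟙 = true
𝟘 = false

_^^_ : Bool → ℕ → Word
w ^^ r = replicate r w

_^w_ : Word → ℕ → Word
U ^w zero = []
U ^w suc k = U ++ (U ^w k)

ShuffleSquare : Word → Set
ShuffleSquare W = ∃ λ U → Interleaving U U W

blockWord : ℕ → ℕ → List ℕ → Word
blockWord r a₁ rest = (𝟙 ^^ a₁) ++ concat (map (λ a → (𝟘 ^^ r) ++ (𝟙 ^^ a)) rest)

open import Relation.Binary.PropositionalEquality using (_≡_)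
open import Data.Nat using (_+_)

Even Odd : ℕ → Set
Even n = ∃ λ t → n ≡ 2 * t
Odd n = ∃ λ t → n ≡ 2 * t + 1

{-# OPTIONS --safe #-}
-- Give every 0 of a word the sign (-1)^k, k the number of 1s before it, and let
-- the weight of the word be the sum of these signs.  Suppose W interleaves two
-- copies of U, and read W from left to right, remembering the parity of the
-- number of 1s each copy has consumed.  Before each 0-block the total number of
-- 1s read is odd, so the two copies are in opposite phases; hence a 0 changes
-- weight U - weight U by the same sign whichever copy takes it, and since the
-- phases stay fixed inside a block, each of the 2m - 1 blocks changes it by ±r.
-- So 0 = weight U - weight U is r times an odd number, which is absurd.
module Submission where

open import Defs
open import Data.Nat using (ℕ; _*_; _≥_; _∸_)
open import Data.List using (_++_; _∷_; [])
open import Data.Vec using (Vec; toList)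
open import Data.Vec.Relation.Unary.All using (All)
open import Data.Product using (_×_)
open import Relation.Nullary using (¬_)

open import Data.Bool using (true; false)
open import Data.Integer.Base as ℤ using (ℤ; +_; -[1+_]; 0ℤ; 1ℤ; -1ℤ)
import Data.Integer.Properties as ℤ
open import Data.Integer.Tactic.RingSolver using (solve-∀)
open import Data.List using (concat; map)
import Data.List.Properties as List
open import Data.List.Relation.Ternary.Interleaving.Propositional
  using (Interleaving; []; consˡ; consʳ)
open import Data.Nat.Base using (zero; suc; parity)
import Data.Nat.Properties as ℕ
open import Data.Parity.Base as ℙ using (Parity; 0ℙ; 1ℙ; _⁻¹)
import Data.Parity.Properties as ℙ
open import Data.Product using (∃; _,_)
open import Data.Sum using ([_,_]′)
open import Data.Vec as Vec using ([]; _∷_)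
open import Data.Vec.Relation.Unary.All using ([]; _∷_)
open import Function using (_∘_)
open import Relation.Binary.PropositionalEquality
  using (_≡_; _≢_; refl; sym; trans; cong; cong₂; subst; module ≡-Reasoning)

open ≡-Reasoning

parity-even : ∀ {n} → Even n → parity n ≡ 0ℙ
parity-even (t , refl) = ℙ.*-homo-* 2 t

parity-odd : ∀ {n} → Odd n → parity n ≡ 1ℙ
parity-odd (t , refl) = trans (ℙ.+-homo-+ (2 * t) 1) (cong (ℙ._+ 1ℙ) (ℙ.*-homo-* 2 t))

parity-suc : ∀ n g → parity n ℙ.+ g ⁻¹ ≡ parity (suc n) ℙ.+ g
parity-suc n g = begin
  parity n ℙ.+ g ⁻¹           ≡⟨ flip-left (parity n) g ⟩
  parity n ⁻¹ ℙ.+ g           ≡⟨ cong (ℙ._+ g) (ℙ.⁻¹-selfInverse (ℙ.suc-homo-⁻¹ n)) ⟩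
  parity (suc n) ℙ.+ g        ∎
  where
  flip-left : ∀ p q → p ℙ.+ q ⁻¹ ≡ p ⁻¹ ℙ.+ q
  flip-left 0ℙ q = refl
  flip-left 1ℙ q = ℙ.⁻¹-involutive q

p+q⁻¹≡[p+q]⁻¹ : ∀ p q → p ℙ.+ q ⁻¹ ≡ (p ℙ.+ q) ⁻¹
p+q⁻¹≡[p+q]⁻¹ 0ℙ q = refl
p+q⁻¹≡[p+q]⁻¹ 1ℙ q = refl

phaseSign : Parity → ℤ
phaseSign 0ℙ = 1ℤ
phaseSign 1ℙ = -1ℤ

phaseSign-odd : ∀ p → ∃ λ d → phaseSign p ≡ 1ℤ ℤ.+ + 2 ℤ.* d
phaseSign-odd 0ℙ = 0ℤ , refl
phaseSign-odd 1ℙ = -1ℤ , refl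

phaseSign-opposite : ∀ p q → p ℙ.+ q ≡ 1ℙ → ℤ.- phaseSign q ≡ phaseSign p
phaseSign-opposite 0ℙ 1ℙ _ = refl
phaseSign-opposite 1ℙ 0ℙ _ = refl

weight : Parity → Word → ℤ
weight p []          = 0ℤ
weight p (true ∷ w)  = weight (p ⁻¹) w
weight p (false ∷ w) = phaseSign p ℤ.+ weight p w

-- A stage in reading an interleaving: left and right are what remains of the two
-- words, and each phase is the parity of the 1s that word has consumed so far.
record Configuration (W : Word) : Set where
  constructor ⟨_,_,_⟩
  field
    {left right}  : Word
    phaseˡ phaseʳ : Parity
    interleaving  : Interleaving left right W

open Configuration

imbalance : ∀ {W} → Configuration W → ℤ
imbalance c = weight (phaseˡ c) (left c) ℤ.- weight (phaseʳ c) (right c)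

gap : ∀ {W} → Configuration W → Parity
gap c = phaseˡ c ℙ.+ phaseʳ c

imbalance-[] : (c : Configuration []) → imbalance c ≡ 0ℤ
imbalance-[] ⟨ p , q , [] ⟩ = refl

readOne : ∀ {b W} → Configuration (b ∷ W) → Configuration W
readOne {true}  ⟨ p , q , consˡ ι ⟩ = ⟨ p ⁻¹ , q , ι ⟩
readOne {true}  ⟨ p , q , consʳ ι ⟩ = ⟨ p , q ⁻¹ , ι ⟩
readOne {false} ⟨ p , q , consˡ ι ⟩ = ⟨ p , q , ι ⟩
readOne {false} ⟨ p , q , consʳ ι ⟩ = ⟨ p , q , ι ⟩

gap-readOne-𝟙 : ∀ {W} (c : Configuration (𝟙 ∷ W)) → gap (readOne c) ≡ gap c ⁻¹
gap-readOne-𝟙 ⟨ p , q , consˡ ι ⟩ = ℙ.+-assoc 1ℙ p q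
gap-readOne-𝟙 ⟨ p , q , consʳ ι ⟩ = p+q⁻¹≡[p+q]⁻¹ p q

imbalance-readOne-𝟙 : ∀ {W} (c : Configuration (𝟙 ∷ W)) → imbalance (readOne c) ≡ imbalance c
imbalance-readOne-𝟙 ⟨ p , q , consˡ ι ⟩ = refl
imbalance-readOne-𝟙 ⟨ p , q , consʳ ι ⟩ = refl

gap-readOne-𝟘 : ∀ {W} (c : Configuration (𝟘 ∷ W)) → gap (readOne c) ≡ gap c
gap-readOne-𝟘 ⟨ p , q , consˡ ι ⟩ = refl
gap-readOne-𝟘 ⟨ p , q , consʳ ι ⟩ = refl

phaseˡ-readOne-𝟘 : ∀ {W} (c : Configuration (𝟘 ∷ W)) → phaseˡ (readOne c) ≡ phaseˡ c
phaseˡ-readOne-𝟘 ⟨ p , q , consˡ ι ⟩ = refl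
phaseˡ-readOne-𝟘 ⟨ p , q , consʳ ι ⟩ = refl

imbalance-readOne-𝟘 : ∀ {W} (c : Configuration (𝟘 ∷ W)) → gap c ≡ 1ℙ →
                      imbalance c ≡ phaseSign (phaseˡ c) ℤ.+ imbalance (readOne c)
imbalance-readOne-𝟘 ⟨ p , q , consˡ ι ⟩ _ = ℤ.+-assoc (phaseSign p) _ _
imbalance-readOne-𝟘 (⟨_,_,_⟩ {L} {_ ∷ M} p q (consʳ ι)) g =
  trans (regroup (phaseSign q) (weight p L) (weight q M))
        (cong (ℤ._+ imbalance ⟨ p , q , ι ⟩) (phaseSign-opposite p q g))
  where
  regroup : ∀ s x y → x ℤ.- (s ℤ.+ y) ≡ ℤ.- s ℤ.+ (x ℤ.- y)
  regroup = solve-∀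

readOnes : ∀ a {W} → Configuration (𝟙 ^^ a ++ W) → Configuration W
readOnes zero    c = c
readOnes (suc a) c = readOnes a (readOne c)

imbalance-readOnes : ∀ a {W} (c : Configuration (𝟙 ^^ a ++ W)) →
                     imbalance (readOnes a c) ≡ imbalance c
imbalance-readOnes zero    c = refl
imbalance-readOnes (suc a) c = trans (imbalance-readOnes a (readOne c)) (imbalance-readOne-𝟙 c)

gap-readOnes : ∀ a {W} (c : Configuration (𝟙 ^^ a ++ W)) →
               gap (readOnes a c) ≡ parity a ℙ.+ gap c
gap-readOnes zero    c = refl
gap-readOnes (suc a) c = begin
  gap (readOnes a (readOne c))  ≡⟨ gap-readOnes a (readOne c) ⟩
  parity a ℙ.+ gap (readOne c)  ≡⟨ cong (parity a ℙ.+_) (gap-readOne-𝟙 c) ⟩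
  parity a ℙ.+ gap c ⁻¹         ≡⟨ parity-suc a (gap c) ⟩
  parity (suc a) ℙ.+ gap c      ∎

-- Stated for (0^r ++ X) ++ Y so that it applies to a block of a concat as is.
readZeros : ∀ r {X Y} → Configuration ((𝟘 ^^ r ++ X) ++ Y) → Configuration (X ++ Y)
readZeros zero    c = c
readZeros (suc r) c = readZeros r (readOne c)

gap-readZeros : ∀ r {X Y} (c : Configuration ((𝟘 ^^ r ++ X) ++ Y)) →
                gap (readZeros r c) ≡ gap c
gap-readZeros zero    c = refl
gap-readZeros (suc r) c = trans (gap-readZeros r (readOne c)) (gap-readOne-𝟘 c)

imbalance-readZeros : ∀ r {X Y} (c : Configuration ((𝟘 ^^ r ++ X) ++ Y)) → gap c ≡ 1ℙ →
  imbalance c ≡ + r ℤ.* phaseSign (phaseˡ c) ℤ.+ imbalance (readZeros r c)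
imbalance-readZeros zero    c _ = sym (ℤ.+-identityˡ (imbalance c))
imbalance-readZeros (suc r) c g = begin
  imbalance c                 ≡⟨ imbalance-readOne-𝟘 c g ⟩
  s ℤ.+ imbalance c′          ≡⟨ cong (ℤ._+_ s) (imbalance-readZeros r c′ g′) ⟩
  s ℤ.+ (+ r ℤ.* s′ ℤ.+ rest) ≡⟨ cong (λ t → s ℤ.+ (+ r ℤ.* t ℤ.+ rest)) s′≡s ⟩
  s ℤ.+ (+ r ℤ.* s ℤ.+ rest)  ≡⟨ absorb (+ r) s rest ⟩
  + suc r ℤ.* s ℤ.+ rest      ∎
  where
  c′   = readOne c
  rest = imbalance (readZeros r c′)
  s    = phaseSign (phaseˡ c)
  s′   = phaseSign (phaseˡ c′)
  s′≡s = cong phaseSign (phaseˡ-readOne-𝟘 c)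
  g′   = trans (gap-readOne-𝟘 c) g
  absorb : ∀ k s x → s ℤ.+ (k ℤ.* s ℤ.+ x) ≡ (1ℤ ℤ.+ k) ℤ.* s ℤ.+ x
  absorb = solve-∀

block : ℕ → ℕ → Word
block r a = 𝟘 ^^ r ++ 𝟙 ^^ a

readBlock : ∀ r a {W} → Configuration (block r a ++ W) → Configuration W
readBlock r a c = readOnes a (readZeros r c)

gap-readBlock : ∀ r a {W} (c : Configuration (block r a ++ W)) →
                gap (readBlock r a c) ≡ parity a ℙ.+ gap c
gap-readBlock r a c = trans (gap-readOnes a (readZeros r c)) (cong (parity a ℙ.+_) (gap-readZeros r c))

imbalance-readBlock : ∀ r a {W} (c : Configuration (block r a ++ W)) → gap c ≡ 1ℙ →
  imbalance c ≡ + r ℤ.* phaseSign (phaseˡ c) ℤ.+ imbalance (readBlock r a c)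
imbalance-readBlock r a c g =
  trans (imbalance-readZeros r c g)
        (cong (ℤ._+_ (+ r ℤ.* phaseSign (phaseˡ c))) (sym (imbalance-readOnes a (readZeros r c))))

imbalance-blocks : ∀ r {n} (mid : Vec ℕ n) aₗ → All Even mid →
  (c : Configuration (concat (map (block r) (toList mid ++ aₗ ∷ [])))) → gap c ≡ 1ℙ →
  ∃ λ j → imbalance c ≡ + r ℤ.* (+ suc n ℤ.+ + 2 ℤ.* j)
imbalance-blocks r [] aₗ [] c g =
  let d , s≡1+2d = phaseSign-odd (phaseˡ c)
  in d , (begin
    imbalance c                                ≡⟨ imbalance-readBlock r aₗ c g ⟩
    + r ℤ.* s ℤ.+ imbalance (readBlock r aₗ c) ≡⟨ cong (ℤ._+_ (+ r ℤ.* s)) (imbalance-[] (readBlock r aₗ c)) ⟩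
    + r ℤ.* s ℤ.+ 0ℤ                           ≡⟨ ℤ.+-identityʳ (+ r ℤ.* s) ⟩
    + r ℤ.* s                                  ≡⟨ cong (ℤ._*_ (+ r)) s≡1+2d ⟩
    + r ℤ.* (1ℤ ℤ.+ + 2 ℤ.* d)                 ∎)
  where
  s = phaseSign (phaseˡ c)
imbalance-blocks r {suc n} (a ∷ mid) aₗ (even-a ∷ evens) c g =
  let d , s≡1+2d = phaseSign-odd (phaseˡ c)
      j , rest   = imbalance-blocks r mid aₗ evens (readBlock r a c) g′
  in d ℤ.+ j , (begin
    imbalance c                                                    ≡⟨ imbalance-readBlock r a c g ⟩
    + r ℤ.* s ℤ.+ imbalance (readBlock r a c)                      ≡⟨ cong₂ (λ t x → + r ℤ.* t ℤ.+ x) s≡1+2d rest ⟩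
    + r ℤ.* (1ℤ ℤ.+ + 2 ℤ.* d) ℤ.+ + r ℤ.* (+ suc n ℤ.+ + 2 ℤ.* j) ≡⟨ collect (+ r) d j (+ suc n) ⟩
    + r ℤ.* (+ suc (suc n) ℤ.+ + 2 ℤ.* (d ℤ.+ j))                  ∎)
  where
  s = phaseSign (phaseˡ c)
  g′ : gap (readBlock r a c) ≡ 1ℙ
  g′ = trans (gap-readBlock r a c) (cong₂ ℙ._+_ (parity-even even-a) g)
  collect : ∀ k d j m → k ℤ.* (1ℤ ℤ.+ + 2 ℤ.* d) ℤ.+ k ℤ.* (m ℤ.+ + 2 ℤ.* j)
                        ≡ k ℤ.* ((1ℤ ℤ.+ m) ℤ.+ + 2 ℤ.* (d ℤ.+ j))
  collect = solve-∀

1+[i+i]≢0 : ∀ i → 1ℤ ℤ.+ (i ℤ.+ i) ≢ 0ℤ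
1+[i+i]≢0 (+ n)    ()
1+[i+i]≢0 -[1+ n ] ()

r*[1+even+2j]≢0 : ∀ {r n} → r ≥ 1 → Even n → ∀ j → + r ℤ.* (+ suc n ℤ.+ + 2 ℤ.* j) ≢ 0ℤ
r*[1+even+2j]≢0 {suc r} _ (t , refl) j r*k≡0 =
  [ (λ ()) , (λ k≡0 → 1+[i+i]≢0 (+ t ℤ.+ j) (trans (sym (regroup (+ t) j)) k≡0)) ]′
    (ℤ.i*j≡0⇒i≡0∨j≡0 (+ suc r) r*k≡0)
  where
  -- The left-hand side is + suc (2 * t) ℤ.+ + 2 ℤ.* j, unfolded.
  regroup : ∀ t j → 1ℤ ℤ.+ (t ℤ.+ (t ℤ.+ 0ℤ)) ℤ.+ + 2 ℤ.* j ≡ 1ℤ ℤ.+ ((t ℤ.+ j) ℤ.+ (t ℤ.+ j))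
  regroup = solve-∀

blockWord-notShuffleSquare : ∀ {r n} a₁ (mid : Vec ℕ n) aₗ → r ≥ 1 → Odd a₁ → All Even mid →
                             Even n → ¬ ShuffleSquare (blockWord r a₁ (toList mid ++ aₗ ∷ []))
blockWord-notShuffleSquare {r} a₁ mid aₗ r≥1 odd-a₁ evens even-n (U , ι) =
  let j , imbalance≡ = imbalance-blocks r mid aₗ evens c gap≡1 in
  r*[1+even+2j]≢0 r≥1 even-n j (begin
    _             ≡⟨ sym imbalance≡ ⟩
    imbalance c   ≡⟨ imbalance-readOnes a₁ c₀ ⟩
    imbalance c₀  ≡⟨ ℤ.+-inverseʳ (weight 0ℙ U) ⟩
    0ℤ            ∎)
  where
  c₀ = ⟨ 0ℙ , 0ℙ , ι ⟩
  c  = readOnes a₁ c₀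
  gap≡1 : gap c ≡ 1ℙ
  gap≡1 = trans (gap-readOnes a₁ c₀) (cong (ℙ._+ 0ℙ) (parity-odd odd-a₁))

replicate⁺ : ∀ {A : Set} {P : A → Set} {x} n → P x → All P (Vec.replicate n x)
replicate⁺ zero    px = []
replicate⁺ (suc n) px = px ∷ replicate⁺ n px

power-as-blockWord : ∀ r n → (((𝟙 ∷ []) ++ (𝟘 ^^ r)) ++ (𝟙 ∷ [])) ^w suc n
                             ≡ blockWord r 1 (toList (Vec.replicate n 2) ++ 1 ∷ [])
power-as-blockWord r zero    = refl
power-as-blockWord r (suc n) = cong (𝟙 ∷_) (begin
  (𝟘 ^^ r ++ 𝟙 ∷ []) ++ U ^w suc n    ≡⟨ cong ((𝟘 ^^ r ++ 𝟙 ∷ []) ++_) (power-as-blockWord r n) ⟩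
  (𝟘 ^^ r ++ 𝟙 ∷ []) ++ 𝟙 ∷ rest      ≡⟨ List.++-assoc (𝟘 ^^ r) (𝟙 ∷ []) (𝟙 ∷ rest) ⟩
  𝟘 ^^ r ++ 𝟙 ∷ 𝟙 ∷ rest             ≡⟨ List.++-assoc (𝟘 ^^ r) (𝟙 ∷ 𝟙 ∷ []) rest ⟨
  (𝟘 ^^ r ++ 𝟙 ∷ 𝟙 ∷ []) ++ rest     ∎)
  where
  U    = ((𝟙 ∷ []) ++ (𝟘 ^^ r)) ++ (𝟙 ∷ [])
  rest = concat (map (block r) (toList (Vec.replicate n 2) ++ 1 ∷ []))

power-notShuffleSquare : ∀ {r n} → r ≥ 1 → Even n →
                         ¬ ShuffleSquare ((((𝟙 ∷ []) ++ (𝟘 ^^ r)) ++ (𝟙 ∷ [])) ^w suc n)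
power-notShuffleSquare {r} {n} r≥1 even-n square =
  blockWord-notShuffleSquare 1 (Vec.replicate n 2) 1 r≥1 (0 , refl) (replicate⁺ n (1 , refl)) even-n
    (subst ShuffleSquare (power-as-blockWord r n) square)

corollary4p5 : (r m : ℕ) → r ≥ 1 → m ≥ 1 →
    ((a₁ aₗ : ℕ) (mid : Vec ℕ (2 * m ∸ 2)) →
      a₁ ≥ 1 → aₗ ≥ 1 → All (λ a → a ≥ 1) mid →
      Odd a₁ → Odd aₗ → All Even mid →
      ¬ ShuffleSquare (blockWord r a₁ (toList mid ++ (aₗ ∷ []))))
  × (¬ ShuffleSquare ((((𝟙 ∷ []) ++ (𝟘 ^^ r)) ++ (𝟙 ∷ [])) ^w (2 * m ∸ 1)))
corollary4p5 r m r≥1 m≥1 =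
    (λ a₁ aₗ mid _ _ _ odd-a₁ _ evens →
       blockWord-notShuffleSquare a₁ mid aₗ r≥1 odd-a₁ evens even-2m∸2)
  , power-notShuffleSquare r≥1 even-2m∸2 ∘ subst (λ k → ShuffleSquare (U ^w k)) 2m∸1≡1+[2m∸2]
  where
  U = ((𝟙 ∷ []) ++ (𝟘 ^^ r)) ++ (𝟙 ∷ [])
  even-2m∸2 : Even (2 * m ∸ 2)
  even-2m∸2 = m ∸ 1 , sym (ℕ.*-distribˡ-∸ 2 m 1)
  2m∸1≡1+[2m∸2] : 2 * m ∸ 1 ≡ suc (2 * m ∸ 2)
  2m∸1≡1+[2m∸2] = ℕ.+-∸-assoc 1 (ℕ.*-monoʳ-≤ 2 m≥1)
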